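{- Let $P_n$ be the path with vertex set $\{0,1,\dots,n-1\}$ and edges $\{i-1,i\}$ for $i=1,\dots,n-1$. Consider one cop chasing a drunk robber on $P_n$, where the cop starts at vertex $0$ and in each round moves from vertex $i$ to vertex $i+1$ (until capture, or until reaching $n-1$). Let $T_n$ be the capture time. Then \[\frac{n}{2}\left(1-O\left(\frac{\log n}{n}\right)\right)\leq \mathbb{E}T_n\leq \frac{n-1}{2},\] where the $O(\cdot)$ refers to $n\to\infty$.
   Context: Drunk robber game: the cop first chooses its initial vertex; then the robber's initial vertex $Y_0$ is chosen uniformly at random from the vertex set. In each round $t=1,2,\dots$ the cop moves first, then the robber moves from his current vertex $v$ to a neighbour of $v$ chosen uniformly at random (he never stays put), independently of the cop's position. The capture time is $T_n=\min\{t: X_t=Y_t\}$, where $X_t$, $Y_t$ are the cop's and robber's positions at time $t$ (capture may occur after the cop's move or after the robber's move). -}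

module Defs where

open import Data.Nat as ℕ using (ℕ; zero; suc; _∸_; _⊓_; _<ᵇ_; _≡ᵇ_)
open import Data.Bool using (Bool; true; false; if_then_else_)
open import Data.Integer using (+_)
open import Data.List using (List; []; _∷_; [_]; _++_; length; map; concatMap; sum; upTo)
open import Data.Product using (_×_; _,_)
open import Data.Rational using (ℚ; 0ℚ; 1ℚ; _/_; _+_; _*_)

toℚ : ℕ → ℚ
toℚ n = + n / 1

-- 1/d as a rational (0 when d = 0; only used with d ≥ 1)
inv : ℕ → ℚ
inv zero    = 0ℚ
inv (suc d) = + 1 / suc d

nbrs : ℕ → ℕ → List ℕ
nbrs n v = (if 0 <ᵇ v then [ v ∸ 1 ] else [])
        ++ (if suc v <ᵇ n then [ suc v ] else [])

-- All robber walks Y_0 = v, Y_1, …, Y_k of k steps on P_n (each step to a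
-- uniformly random neighbour), together with their probabilities.
walks : ℕ → ℕ → ℕ → List (ℚ × List ℕ)
walks n zero    v = [ (1ℚ , v ∷ []) ]
walks n (suc k) v =
  concatMap (λ u → map (λ { (p , w) → (inv (length (nbrs n v)) * p , v ∷ w) })
                       (walks n k u))
            (nbrs n v)

cop : ℕ → ℕ → ℕ
cop n t = t ⊓ (n ∸ 1)

-- Capture time along a robber trajectory (Y_t, Y_{t+1}, …) starting at time t:
-- capture at time t if X_t = Y_t; otherwise the cop moves and captures at
-- time t+1 if X_{t+1} = Y_t (before the robber moves); otherwise the robber
-- moves and we continue at time t+1.  (The [] case is never reached for walks
-- of length n-1, since the cop reaches n-1 by time n-1.)
capT : ℕ → ℕ → List ℕ → ℕ
capT n t []       = t
capT n t (y ∷ ys) =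
  if cop n t ≡ᵇ y then t
  else if cop n (suc t) ≡ᵇ y then suc t
  else capT n (suc t) ys

expect : List (ℚ × List ℕ) → (List ℕ → ℕ) → ℚ
expect xs f = Data.List.foldr (λ { (p , w) acc → p * toℚ (f w) + acc }) 0ℚ xs

-- 𝔼 T_n : Y_0 uniform on {0,…,n-1}; the robber walk is followed for n-1
-- rounds, which suffices since capture happens by time n-1.
ET : ℕ → ℚ
ET n = inv n * Data.List.foldr _+_ 0ℚ
         (map (λ y₀ → expect (walks n (n ∸ 1) y₀) (capT n 0)) (upTo n))

module Submission where

-- Let D be the gap between robber and cop and d the robber's distance to the end of the path.
-- Away from the end, time + D is a martingale; at the end it drops by one; at capture it is
-- the capture time.  So the capture time from a start at y is at most y, whose mean is
-- (n-1)/2.  For the lower bound the drops are paid for by the potential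
-- φ(D, d) = (2D + A)/(d + b + 1) with A = (b+1)(b+2) and b ≈ 2√n: it loses at least one
-- at the end and is a supermartingale elsewhere (as long as 2D ≤ A), so time + D is at most
-- the capture time plus φ, and the potentials of all starting vertices add up to
-- O(n log n) through the harmonic series.

open import Defs
open import Data.Bool using (true; false; T)
open import Data.Bool.Properties using (T-≡)
open import Data.Integer as ℤ using (+_)
import Data.Integer.Properties as ℤ
open import Data.List using (List; []; _∷_; [_]; _++_; length; map; foldr; concatMap; applyUpTo; upTo)
open import Data.List.Properties using (map-upTo; upTo-∷ʳ)
open import Data.Nat using (ℕ; zero; suc; _∸_; z≤n; s≤s; _≡ᵇ_; _<ᵇ_; ⌊_/2⌋; ⌈_/2⌉)
import Data.Nat as ℕ
import Data.Nat.Properties as ℕ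
open import Data.Nat.Induction using (<-wellFounded)
open import Data.Nat.ListAction using (sum)
open import Data.Nat.ListAction.Properties using (sum-++)
open import Data.Nat.Logarithm using (⌊log₂_⌋; ⌊log₂⌊n/2⌋⌋≡⌊log₂n⌋∸1; ⌊log₂⌋-mono-≤)
open import Data.Nat.Tactic.RingSolver using (solve-∀)
open import Data.Product using (_×_; _,_; ∃)
open import Data.Rational using (ℚ; 0ℚ; 1ℚ; _+_; _*_; _-_; -_; _/_; _≤_; toℚᵘ; nonNegative)
import Data.Rational.Properties as ℚ
open import Data.Rational.Solver using (module +-*-Solver)
import Data.Rational.Unnormalised as ℚᵘ
import Data.Rational.Unnormalised.Properties as ℚᵘ
open import Function using (_∘_; Equivalence)
open import Induction.WellFounded using (Acc; acc)
open import Relation.Binary.PropositionalEquality hiding ([_])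
open import Relation.Nullary using (¬_; contradiction; yes; no)

open +-*-Solver

toℚᵘ-frac : ∀ a p → toℚᵘ (+ a / suc p) ℚᵘ.≃ ℚᵘ.mkℚᵘ (+ a) p
toℚᵘ-frac a p = ℚ.toℚᵘ-fromℚᵘ (ℚᵘ.mkℚᵘ (+ a) p)

frac-≤ : ∀ a p c q → a ℕ.* suc q ℕ.≤ c ℕ.* suc p → + a / suc p ≤ + c / suc q
frac-≤ a p c q h = ℚ.toℚᵘ-cancel-≤
  (ℚᵘ.≤-respˡ-≃ (ℚᵘ.≃-sym (toℚᵘ-frac a p)) (ℚᵘ.≤-respʳ-≃ (ℚᵘ.≃-sym (toℚᵘ-frac c q))
    (ℚᵘ.*≤* (subst₂ ℤ._≤_ (ℤ.pos-* a (suc q)) (ℤ.pos-* c (suc p)) (ℤ.+≤+ h)))))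

frac-≡ : ∀ a p c q → a ℕ.* suc q ≡ c ℕ.* suc p → + a / suc p ≡ + c / suc q
frac-≡ a p c q h = ℚ.≤-antisym (frac-≤ a p c q (ℕ.≤-reflexive h)) (frac-≤ c q a p (ℕ.≤-reflexive (sym h)))

frac-+ : ∀ a p c q → + a / suc p + + c / suc q ≡ + (a ℕ.* suc q ℕ.+ c ℕ.* suc p) / (suc p ℕ.* suc q)
frac-+ a p c q = ℚ.toℚᵘ-injective (ℚᵘ.≃-trans (ℚ.toℚᵘ-homo-+ (+ a / suc p) (+ c / suc q))
  (ℚᵘ.≃-trans (ℚᵘ.+-cong (toℚᵘ-frac a p) (toℚᵘ-frac c q)) (ℚᵘ.≃-trans (ℚᵘ.≃-reflexive numerators) (ℚᵘ.≃-sym (toℚᵘ-frac _ _)))))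
  where
  numerators : ℚᵘ.mkℚᵘ (+ a) p ℚᵘ.+ ℚᵘ.mkℚᵘ (+ c) q ≡ ℚᵘ.mkℚᵘ (+ (a ℕ.* suc q ℕ.+ c ℕ.* suc p)) (q ℕ.+ p ℕ.* suc q)
  numerators = cong (λ z → ℚᵘ.mkℚᵘ z (q ℕ.+ p ℕ.* suc q))
    (trans (cong₂ ℤ._+_ (sym (ℤ.pos-* a (suc q))) (sym (ℤ.pos-* c (suc p)))) (sym (ℤ.pos-+ (a ℕ.* suc q) (c ℕ.* suc p))))

frac-* : ∀ a p c q → (+ a / suc p) * (+ c / suc q) ≡ + (a ℕ.* c) / (suc p ℕ.* suc q)
frac-* a p c q = ℚ.toℚᵘ-injective (ℚᵘ.≃-trans (ℚ.toℚᵘ-homo-* (+ a / suc p) (+ c / suc q))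
  (ℚᵘ.≃-trans (ℚᵘ.*-cong (toℚᵘ-frac a p) (toℚᵘ-frac c q)) (ℚᵘ.≃-trans (ℚᵘ.≃-reflexive numerators) (ℚᵘ.≃-sym (toℚᵘ-frac _ _)))))
  where
  numerators : ℚᵘ.mkℚᵘ (+ a) p ℚᵘ.* ℚᵘ.mkℚᵘ (+ c) q ≡ ℚᵘ.mkℚᵘ (+ (a ℕ.* c)) (q ℕ.+ p ℕ.* suc q)
  numerators = cong (λ z → ℚᵘ.mkℚᵘ z (q ℕ.+ p ℕ.* suc q)) (sym (ℤ.pos-* a c))

toℚ-mono-≤ : ∀ {a c} → a ℕ.≤ c → toℚ a ≤ toℚ c
toℚ-mono-≤ {a} {c} h = frac-≤ a 0 c 0 (ℕ.*-monoˡ-≤ 1 h)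

toℚ-+ : ∀ a c → toℚ (a ℕ.+ c) ≡ toℚ a + toℚ c
toℚ-+ a c = sym (trans (frac-+ a 0 c 0) (frac-≡ (a ℕ.* 1 ℕ.+ c ℕ.* 1) 0 (a ℕ.+ c) 0 (rearrange a c)))
  where
  rearrange : ∀ a c → (a ℕ.* 1 ℕ.+ c ℕ.* 1) ℕ.* 1 ≡ (a ℕ.+ c) ℕ.* 1
  rearrange = solve-∀

toℚ-* : ∀ a c → toℚ (a ℕ.* c) ≡ toℚ a * toℚ c
toℚ-* a c = sym (frac-* a 0 c 0)

toℚ-nonNeg : ∀ a → 0ℚ ≤ toℚ a
toℚ-nonNeg a = toℚ-mono-≤ {0} {a} z≤n

inv-nonNeg : ∀ a → 0ℚ ≤ inv a
inv-nonNeg zero    = ℚ.≤-refl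
inv-nonNeg (suc a) = frac-≤ 0 0 1 a z≤n

inv-antitone : ∀ {a c} → a ℕ.≤ c → inv (suc c) ≤ inv (suc a)
inv-antitone {a} {c} h = frac-≤ 1 c 1 a (ℕ.*-monoʳ-≤ 1 (s≤s h))

*-monoʳ-≤-inv : ∀ a {x y} → x ≤ y → inv a * x ≤ inv a * y
*-monoʳ-≤-inv a = ℚ.*-monoˡ-≤-nonNeg (inv a) {{nonNegative (inv-nonNeg a)}}

half+half : ∀ x → inv 2 * x + inv 2 * x ≡ x
half+half x = trans (sym (ℚ.*-distribʳ-+ x (inv 2) (inv 2))) (ℚ.*-identityˡ x)

x≤x+nonNeg : ∀ x {y} → 0ℚ ≤ y → x ≤ x + y
x≤x+nonNeg x 0≤y = ℚ.≤-trans (ℚ.≤-reflexive (sym (ℚ.+-identityʳ x))) (ℚ.+-monoʳ-≤ x 0≤y)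

toℚ-*-inv : ∀ c d → toℚ c * inv (suc d) ≡ + c / suc d
toℚ-*-inv c d = trans (frac-* c 0 1 d) (frac-≡ (c ℕ.* 1) (d ℕ.+ 0 ℕ.* suc d) c d (unit c d))
  where
  unit : ∀ c d → c ℕ.* 1 ℕ.* suc d ≡ c ℕ.* (1 ℕ.* suc d)
  unit = solve-∀

inv-*-toℚ-cancel : ∀ m c → inv (suc m) * toℚ (suc m ℕ.* c) ≡ toℚ c
inv-*-toℚ-cancel m c = trans (frac-* 1 m (suc m ℕ.* c) 0) (frac-≡ (1 ℕ.* (suc m ℕ.* c)) _ c 0 (rearrange m c))
  where
  rearrange : ∀ m c → 1 ℕ.* (suc m ℕ.* c) ℕ.* 1 ≡ c ℕ.* (suc m ℕ.* 1)
  rearrange = solve-∀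

p≤r+q⇒p-q≤r : ∀ p q r → p ≤ r + q → p - q ≤ r
p≤r+q⇒p-q≤r p q r p≤r+q = ℚ.≤-trans (ℚ.+-monoˡ-≤ (- q) p≤r+q) (ℚ.≤-reflexive (cancel r q))
  where
  cancel : ∀ r q → r + q - q ≡ r
  cancel = solve 2 (λ r q → r :+ q :- q := r) refl

∑ : ℕ → (ℕ → ℚ) → ℚ
∑ n f = foldr _+_ 0ℚ (applyUpTo f n)

∑-cong : ∀ n {f g : ℕ → ℚ} → (∀ y → y ℕ.< n → f y ≡ g y) → ∑ n f ≡ ∑ n g
∑-cong zero    e = refl
∑-cong (suc n) e = cong₂ _+_ (e 0 (s≤s z≤n)) (∑-cong n (λ y y<n → e (suc y) (s≤s y<n)))

∑-mono-≤ : ∀ n {f g : ℕ → ℚ} → (∀ y → y ℕ.< n → f y ≤ g y) → ∑ n f ≤ ∑ n g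
∑-mono-≤ zero    h = ℚ.≤-refl
∑-mono-≤ (suc n) h = ℚ.+-mono-≤ (h 0 (s≤s z≤n)) (∑-mono-≤ n (λ y y<n → h (suc y) (s≤s y<n)))

∑-+ : ∀ n (f g : ℕ → ℚ) → ∑ n (λ y → f y + g y) ≡ ∑ n f + ∑ n g
∑-+ zero    f g = refl
∑-+ (suc n) f g = trans (cong (_+_ (f 0 + g 0)) (∑-+ n (f ∘ suc) (g ∘ suc)))
  (interchange (f 0) (g 0) (∑ n (f ∘ suc)) (∑ n (g ∘ suc)))
  where
  interchange : ∀ a b c d → a + b + (c + d) ≡ a + c + (b + d)
  interchange = solve 4 (λ a b c d → a :+ b :+ (c :+ d) := a :+ c :+ (b :+ d)) refl

∑-*ˡ : ∀ n c (f : ℕ → ℚ) → ∑ n (λ y → c * f y) ≡ c * ∑ n f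
∑-*ˡ zero    c f = sym (ℚ.*-zeroʳ c)
∑-*ˡ (suc n) c f = trans (cong (_+_ (c * f 0)) (∑-*ˡ n c (f ∘ suc))) (sym (ℚ.*-distribˡ-+ c (f 0) _))

∑-toℚ : ∀ n (f : ℕ → ℕ) → ∑ n (toℚ ∘ f) ≡ toℚ (sum (applyUpTo f n))
∑-toℚ zero    f = refl
∑-toℚ (suc n) f = trans (cong (_+_ (toℚ (f 0))) (∑-toℚ n (f ∘ suc))) (sym (toℚ-+ (f 0) _))

sum-upTo : ∀ n → sum (upTo n) ℕ.* 2 ℕ.+ n ≡ n ℕ.* n
sum-upTo zero    = refl
sum-upTo (suc n) = begin
  sum (upTo (suc n)) ℕ.* 2 ℕ.+ suc n         ≡⟨ cong (λ xs → sum xs ℕ.* 2 ℕ.+ suc n) (sym (upTo-∷ʳ n)) ⟩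
  sum (upTo n ++ [ n ]) ℕ.* 2 ℕ.+ suc n      ≡⟨ cong (λ s → s ℕ.* 2 ℕ.+ suc n) (sum-++ (upTo n) [ n ]) ⟩
  (sum (upTo n) ℕ.+ (n ℕ.+ 0)) ℕ.* 2 ℕ.+ suc n ≡⟨ step (sum (upTo n)) n ⟩
  sum (upTo n) ℕ.* 2 ℕ.+ n ℕ.+ (1 ℕ.+ n ℕ.* 2) ≡⟨ cong (ℕ._+ (1 ℕ.+ n ℕ.* 2)) (sum-upTo n) ⟩
  n ℕ.* n ℕ.+ (1 ℕ.+ n ℕ.* 2)               ≡⟨ square n ⟩
  suc n ℕ.* suc n ∎
  where
  open ≡-Reasoning
  step : ∀ s n → (s ℕ.+ (n ℕ.+ 0)) ℕ.* 2 ℕ.+ suc n ≡ s ℕ.* 2 ℕ.+ n ℕ.+ (1 ℕ.+ n ℕ.* 2)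
  step = solve-∀
  square : ∀ n → n ℕ.* n ℕ.+ (1 ℕ.+ n ℕ.* 2) ≡ suc n ℕ.* suc n
  square = solve-∀

mean-upTo : ∀ m → inv (suc m) * ∑ (suc m) toℚ ≡ + m / 2
mean-upTo m = begin
  inv (suc m) * ∑ (suc m) toℚ     ≡⟨ cong (inv (suc m) *_) (∑-toℚ (suc m) (λ y → y)) ⟩
  inv (suc m) * toℚ S             ≡⟨ frac-* 1 m S 0 ⟩
  + (1 ℕ.* S) / (suc m ℕ.* 1)     ≡⟨ frac-≡ (1 ℕ.* S) _ m 1 twice-S ⟩
  + m / 2 ∎
  where
  open ≡-Reasoning
  S = sum (upTo (suc m))
  twice-S : 1 ℕ.* S ℕ.* 2 ≡ m ℕ.* (suc m ℕ.* 1)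
  twice-S = ℕ.+-cancelʳ-≡ (suc m) _ _ (trans (sum-upTo' S) (trans (sum-upTo (suc m)) (square m)))
    where
    sum-upTo' : ∀ S → 1 ℕ.* S ℕ.* 2 ℕ.+ suc m ≡ S ℕ.* 2 ℕ.+ suc m
    sum-upTo' S = cong (λ s → s ℕ.* 2 ℕ.+ suc m) (ℕ.*-identityˡ S)
    square : ∀ m → suc m ℕ.* suc m ≡ m ℕ.* (suc m ℕ.* 1) ℕ.+ suc m
    square = solve-∀

harmonic : ℕ → ℚ
harmonic zero    = 0ℚ
harmonic (suc n) = inv (suc n) + harmonic n

∑-inv-reversed : ∀ n → ∑ n (λ y → inv (n ∸ y)) ≡ harmonic n
∑-inv-reversed zero    = refl
∑-inv-reversed (suc n) = cong (_+_ (inv (suc n))) (∑-inv-reversed n)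

harmonic-+ : ∀ m k → harmonic (m ℕ.+ k) ≤ harmonic m + toℚ k * inv (suc m)
harmonic-+ m zero = ℚ.≤-reflexive (begin
  harmonic (m ℕ.+ 0)                ≡⟨ cong harmonic (ℕ.+-identityʳ m) ⟩
  harmonic m                        ≡⟨ sym (ℚ.+-identityʳ (harmonic m)) ⟩
  harmonic m + 0ℚ                   ≡⟨ cong (_+_ (harmonic m)) (sym (ℚ.*-zeroˡ (inv (suc m)))) ⟩
  harmonic m + toℚ 0 * inv (suc m) ∎)
  where open ≡-Reasoning
harmonic-+ m (suc k) = begin
  harmonic (m ℕ.+ suc k)                          ≡⟨ cong harmonic (ℕ.+-suc m k) ⟩
  inv (suc (m ℕ.+ k)) + harmonic (m ℕ.+ k)        ≤⟨ ℚ.+-mono-≤ (inv-antitone (ℕ.m≤m+n m k)) (harmonic-+ m k) ⟩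
  inv (suc m) + (harmonic m + toℚ k * inv (suc m)) ≡⟨ regroup (inv (suc m)) (harmonic m) (toℚ k) ⟩
  harmonic m + (1ℚ + toℚ k) * inv (suc m)         ≡⟨ cong (λ z → harmonic m + z * inv (suc m)) (sym (toℚ-+ 1 k)) ⟩
  harmonic m + toℚ (suc k) * inv (suc m) ∎
  where
  open ℚ.≤-Reasoning
  regroup : ∀ i h t → i + (h + t * i) ≡ h + (1ℚ + t) * i
  regroup = solve 3 (λ i h t → i :+ (h :+ t :* i) := h :+ (con 1ℚ :+ t) :* i) refl

harmonic-halve : ∀ n → harmonic n ≤ harmonic ⌊ n /2⌋ + 1ℚ
harmonic-halve n = begin
  harmonic n                         ≡⟨ cong harmonic (sym (ℕ.⌊n/2⌋+⌈n/2⌉≡n n)) ⟩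
  harmonic (h ℕ.+ k)                 ≤⟨ harmonic-+ h k ⟩
  harmonic h + toℚ k * inv (suc h)   ≡⟨ cong (_+_ (harmonic h)) (toℚ-*-inv k h) ⟩
  harmonic h + + k / suc h           ≤⟨ ℚ.+-monoʳ-≤ (harmonic h) (frac-≤ k h 1 0 k≤1+h) ⟩
  harmonic h + 1ℚ ∎
  where
  open ℚ.≤-Reasoning
  h = ⌊ n /2⌋
  k = ⌈ n /2⌉
  k≤1+h : k ℕ.* 1 ℕ.≤ 1 ℕ.* suc h
  k≤1+h = subst₂ ℕ._≤_ (sym (ℕ.*-identityʳ k)) (sym (ℕ.*-identityˡ (suc h))) (ℕ.⌊n/2⌋-mono (ℕ.n≤1+n (suc n)))

harmonic-≤-log₂ : ∀ n → harmonic (suc n) ≤ toℚ (suc ⌊log₂ suc n ⌋)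
harmonic-≤-log₂ n = go n (<-wellFounded n)
  where
  go : ∀ n → Acc ℕ._<_ n → harmonic (suc n) ≤ toℚ (suc ⌊log₂ suc n ⌋)
  go zero    _         = ℚ.≤-refl
  go (suc n) (acc rec) = begin
    harmonic (suc (suc n))                  ≤⟨ harmonic-halve (suc (suc n)) ⟩
    harmonic (suc h) + 1ℚ                   ≤⟨ ℚ.+-monoˡ-≤ 1ℚ (go h (rec (s≤s (ℕ.⌊n/2⌋≤n n)))) ⟩
    toℚ (suc ⌊log₂ suc h ⌋) + toℚ 1        ≡⟨ sym (toℚ-+ (suc ⌊log₂ suc h ⌋) 1) ⟩
    toℚ (suc ⌊log₂ suc h ⌋ ℕ.+ 1)          ≡⟨ cong (toℚ ∘ suc) log-halve ⟩
    toℚ (suc ⌊log₂ suc (suc n) ⌋) ∎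
    where
    open ℚ.≤-Reasoning
    h = ⌊ n /2⌋
    log-halve : ⌊log₂ suc h ⌋ ℕ.+ 1 ≡ ⌊log₂ suc (suc n) ⌋
    log-halve = trans (cong (ℕ._+ 1) (⌊log₂⌊n/2⌋⌋≡⌊log₂n⌋∸1 (suc (suc n))))
                      (ℕ.m∸n+n≡m (⌊log₂⌋-mono-≤ {2} {suc (suc n)} (s≤s (s≤s z≤n))))

¬T⇒≡false : ∀ {b} → ¬ T b → b ≡ false
¬T⇒≡false {false} _   = refl
¬T⇒≡false {true}  ¬tt = contradiction _ ¬tt

≡ᵇ-true : ∀ {m n} → m ≡ n → (m ≡ᵇ n) ≡ true
≡ᵇ-true {m} {n} m≡n = Equivalence.to T-≡ (ℕ.≡⇒≡ᵇ m n m≡n)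

≡ᵇ-false : ∀ {m n} → m ≢ n → (m ≡ᵇ n) ≡ false
≡ᵇ-false {m} {n} m≢n = ¬T⇒≡false (m≢n ∘ ℕ.≡ᵇ⇒≡ m n)

<ᵇ-true : ∀ {m n} → m ℕ.< n → (m <ᵇ n) ≡ true
<ᵇ-true m<n = Equivalence.to T-≡ (ℕ.<⇒<ᵇ m<n)

<ᵇ-false : ∀ {m n} → ¬ m ℕ.< n → (m <ᵇ n) ≡ false
<ᵇ-false {m} {n} m≮n = ¬T⇒≡false (m≮n ∘ ℕ.<ᵇ⇒< m n)

expect-++ : ∀ xs ys (f : List ℕ → ℕ) → expect (xs ++ ys) f ≡ expect xs f + expect ys f
expect-++ []             ys f = sym (ℚ.+-identityˡ _)
expect-++ ((p , w) ∷ xs) ys f =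
  trans (cong (_+_ (p * toℚ (f w))) (expect-++ xs ys f)) (sym (ℚ.+-assoc (p * toℚ (f w)) _ _))

expect-cong : ∀ xs {f g : List ℕ → ℕ} → (∀ w → f w ≡ g w) → expect xs f ≡ expect xs g
expect-cong []             e = refl
expect-cong ((p , w) ∷ xs) e = cong₂ (λ a b → p * toℚ a + b) (e w) (expect-cong xs e)

expect-map-prepend : ∀ q v xs (f : List ℕ → ℕ) →
  expect (map (λ (p , w) → (q * p , v ∷ w)) xs) f ≡ q * expect xs (f ∘ (v ∷_))
expect-map-prepend q v []             f = sym (ℚ.*-zeroʳ q)
expect-map-prepend q v ((p , w) ∷ xs) f = begin
  q * p * toℚ (f (v ∷ w)) + expect (map _ xs) f            ≡⟨ cong₂ _+_ (ℚ.*-assoc q p _) (expect-map-prepend q v xs f) ⟩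
  q * (p * toℚ (f (v ∷ w))) + q * expect xs (f ∘ (v ∷_))  ≡⟨ sym (ℚ.*-distribˡ-+ q _ _) ⟩
  q * (p * toℚ (f (v ∷ w)) + expect xs (f ∘ (v ∷_))) ∎
  where open ≡-Reasoning

neighbourMean : ℕ → ℕ → (ℕ → ℚ) → ℚ
neighbourMean n v g = foldr (λ u acc → inv (length (nbrs n v)) * g u + acc) 0ℚ (nbrs n v)

neighbourMean-cong : ∀ n v {g h : ℕ → ℚ} → (∀ u → g u ≡ h u) → neighbourMean n v g ≡ neighbourMean n v h
neighbourMean-cong n v {g} {h} g≡h = go (nbrs n v)
  where
  go : ∀ us → foldr (λ u acc → inv (length (nbrs n v)) * g u + acc) 0ℚ us
            ≡ foldr (λ u acc → inv (length (nbrs n v)) * h u + acc) 0ℚ us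
  go []       = refl
  go (u ∷ us) = cong₂ (λ a b → inv (length (nbrs n v)) * a + b) (g≡h u) (go us)

expect-walks-suc : ∀ n k v (f : List ℕ → ℕ) →
  expect (walks n (suc k) v) f ≡ neighbourMean n v (λ u → expect (walks n k u) (f ∘ (v ∷_)))
expect-walks-suc n k v f = go (nbrs n v)
  where
  q = inv (length (nbrs n v))
  go : ∀ us → expect (concatMap (λ u → map (λ (p , w) → (q * p , v ∷ w)) (walks n k u)) us) f
            ≡ foldr (λ u acc → q * expect (walks n k u) (f ∘ (v ∷_)) + acc) 0ℚ us
  go []       = refl
  go (u ∷ us) = trans (expect-++ (map _ (walks n k u)) _ f)
    (cong₂ _+_ (expect-map-prepend q v (walks n k u) f) (go us))

neighbourMean-origin : ∀ n (g : ℕ → ℚ) → 1 ℕ.< n → neighbourMean n 0 g ≡ g 1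
neighbourMean-origin n g 1<n rewrite <ᵇ-true 1<n = trans (ℚ.+-identityʳ _) (ℚ.*-identityˡ (g 1))

neighbourMean-wall : ∀ n x (g : ℕ → ℚ) → ¬ suc (suc x) ℕ.< n → neighbourMean n (suc x) g ≡ g x
neighbourMean-wall n x g x+2≮n rewrite <ᵇ-false x+2≮n = trans (ℚ.+-identityʳ _) (ℚ.*-identityˡ (g x))

neighbourMean-interior : ∀ n x (g : ℕ → ℚ) → suc (suc x) ℕ.< n →
  neighbourMean n (suc x) g ≡ inv 2 * g x + inv 2 * g (suc (suc x))
neighbourMean-interior n x g x+2<n rewrite <ᵇ-true x+2<n = cong (_+_ (inv 2 * g x)) (ℚ.+-identityʳ _)

neighbourMean-const : ∀ n v {g : ℕ → ℚ} {c} → v ℕ.< n → 1 ℕ.< n → (∀ u → u ℕ.< n → g u ≡ c) →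
  neighbourMean n v g ≡ c
neighbourMean-const n zero    _ 1<n g≡c = trans (neighbourMean-origin n _ 1<n) (g≡c 1 1<n)
neighbourMean-const n (suc x) {g} {c} v<n _ g≡c with suc (suc x) ℕ.<? n
... | yes x+2<n = begin
  neighbourMean n (suc x) g               ≡⟨ neighbourMean-interior n x g x+2<n ⟩
  inv 2 * g x + inv 2 * g (suc (suc x))  ≡⟨ cong₂ (λ a b → inv 2 * a + inv 2 * b) (g≡c x (ℕ.<-trans (ℕ.n<1+n x) v<n)) (g≡c _ x+2<n) ⟩
  inv 2 * c + inv 2 * c                  ≡⟨ half+half c ⟩
  c ∎
  where open ≡-Reasoning
... | no x+2≮n = trans (neighbourMean-wall n x g x+2≮n) (g≡c x (ℕ.<-trans (ℕ.n<1+n x) v<n))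

expect-walks-fixed : ∀ n k v {f : List ℕ → ℕ} {c} → v ℕ.< n → k ℕ.< n → (∀ w → f (v ∷ w) ≡ c) →
  expect (walks n k v) f ≡ toℚ c
expect-walks-fixed n zero    v v<n _   f≡c = trans (ℚ.+-identityʳ _) (trans (ℚ.*-identityˡ _) (cong toℚ (f≡c [])))
expect-walks-fixed n (suc k) v {f} v<n k<n f≡c = trans (expect-walks-suc n k v f)
  (neighbourMean-const n v v<n (ℕ.≤-<-trans (s≤s z≤n) k<n)
    (λ u u<n → expect-walks-fixed n k u {f ∘ (v ∷_)} u<n (ℕ.<-trans (ℕ.n<1+n k) k<n) (λ w → f≡c (u ∷ w))))

cop-< : ∀ {n t} → t ℕ.< n → cop n t ≡ t
cop-< {suc m} (s≤s t≤m) = ℕ.m≤n⇒m⊓n≡m t≤m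

capT-caught : ∀ n t {y} ys → cop n t ≡ y → capT n t (y ∷ ys) ≡ t
capT-caught n t ys caught rewrite ≡ᵇ-true caught = refl

capT-caught-next : ∀ n t {y} ys → cop n t ≢ y → cop n (suc t) ≡ y → capT n t (y ∷ ys) ≡ suc t
capT-caught-next n t ys missed caught rewrite ≡ᵇ-false missed | ≡ᵇ-true caught = refl

capT-escape : ∀ n t {y} ys → cop n t ≢ y → cop n (suc t) ≢ y → capT n t (y ∷ ys) ≡ capT n (suc t) ys
capT-escape n t ys missed missed′ rewrite ≡ᵇ-false missed | ≡ᵇ-false missed′ = refl

expect-capT-escape : ∀ n k t v → cop n t ≢ v → cop n (suc t) ≢ v →
  expect (walks n (suc k) v) (capT n t) ≡ neighbourMean n v (λ u → expect (walks n k u) (capT n (suc t)))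
expect-capT-escape n k t v missed missed′ = trans (expect-walks-suc n k v (capT n t))
  (neighbourMean-cong n v (λ u → expect-cong (walks n k u) (λ w → capT-escape n t w missed missed′)))

-- The expected capture time when at time t the robber is D vertices ahead of the cop and d
-- vertices before the end of the path, so that D + d = k rounds remain.
capture : (k t D d : ℕ) → ℚ
capture _       t 0             _       = toℚ t
capture _       t 1             _       = toℚ (suc t)
capture zero    t (suc (suc D)) _       = 0ℚ
capture (suc k) t (suc (suc D)) zero    = capture k (suc t) D 1
capture (suc k) t (suc (suc D)) (suc d) =
  inv 2 * capture k (suc t) D (suc (suc d)) + inv 2 * capture k (suc t) (suc (suc D)) d

module _ {n : ℕ} (t D d : ℕ) (n≡ : suc (t ℕ.+ D ℕ.+ d) ≡ n) where

  robber<n : t ℕ.+ D ℕ.< n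
  robber<n = subst (t ℕ.+ D ℕ.<_) n≡ (s≤s (ℕ.m≤m+n (t ℕ.+ D) d))

  cop<n : t ℕ.< n
  cop<n = ℕ.≤-<-trans (ℕ.m≤m+n t D) robber<n

  rounds<n : D ℕ.+ d ℕ.< n
  rounds<n = subst (D ℕ.+ d ℕ.<_) n≡ (s≤s (ℕ.+-monoˡ-≤ d (ℕ.m≤n+m D t)))

expect-capT-ahead : ∀ t D d k → let n = suc (t ℕ.+ suc (suc D) ℕ.+ d) in
  expect (walks n (suc k) (t ℕ.+ suc (suc D))) (capT n t)
    ≡ neighbourMean n (suc (suc (t ℕ.+ D))) (λ u → expect (walks n k u) (capT n (suc t)))
expect-capT-ahead t D d k =
  trans (expect-capT-escape n k t v missed missed′)
        (cong (λ v → neighbourMean n v (λ u → expect (walks n k u) (capT n (suc t)))) v≡)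
  where
  n = suc (t ℕ.+ suc (suc D) ℕ.+ d)
  v = t ℕ.+ suc (suc D)
  t<n : t ℕ.< n
  t<n = cop<n t (suc (suc D)) d refl
  v≡ : v ≡ suc (suc (t ℕ.+ D))
  v≡ = trans (ℕ.+-suc t (suc D)) (cong suc (ℕ.+-suc t D))
  missed : cop n t ≢ v
  missed e = ℕ.m+1+n≢m t (sym (trans (sym (cop-< t<n)) e))
  missed′ : cop n (suc t) ≢ v
  missed′ e = ℕ.m+1+n≢m t (sym (ℕ.suc-injective (trans (sym (cop-< t+1<n)) (trans e (ℕ.+-suc t (suc D))))))
    where
    t+1<n : suc t ℕ.< n
    t+1<n = ℕ.≤-<-trans (subst (ℕ._≤ v) (ℕ.+-comm t 1) (ℕ.+-monoʳ-≤ t (s≤s z≤n))) (robber<n t (suc (suc D)) d refl)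

expect-capT≡capture : ∀ {n k} t D d {v} → t ℕ.+ D ≡ v → D ℕ.+ d ≡ k → suc (t ℕ.+ D ℕ.+ d) ≡ n →
  expect (walks n k v) (capT n t) ≡ capture k t D d
expect-capT≡capture {n} t 0 d refl refl n≡ =
  expect-walks-fixed n d (t ℕ.+ 0) {capT n t} (robber<n t _ d n≡) (rounds<n t _ d n≡)
    (λ w → capT-caught n t w (trans (cop-< (cop<n t _ d n≡)) (sym (ℕ.+-identityʳ t))))
expect-capT≡capture {n} t 1 d refl refl n≡ =
  expect-walks-fixed n (suc d) (t ℕ.+ 1) {capT n t} (robber<n t _ d n≡) (rounds<n t _ d n≡)
    (λ w → capT-caught-next n t w missed caught)
  where
  t+1≡ : t ℕ.+ 1 ≡ suc t
  t+1≡ = ℕ.+-comm t 1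
  missed : cop n t ≢ t ℕ.+ 1
  missed e = ℕ.m+1+n≢m t (sym (trans (sym (cop-< (cop<n t 1 d n≡))) e))
  caught : cop n (suc t) ≡ t ℕ.+ 1
  caught = trans (cop-< (subst (ℕ._< n) t+1≡ (robber<n t 1 d n≡))) (sym t+1≡)
expect-capT≡capture t (suc (suc D)) zero refl refl refl =
  trans (expect-capT-ahead t D 0 (suc (D ℕ.+ 0)))
    (trans (neighbourMean-wall n x E (ℕ.<-irrefl (wall≡ t D)))
           (expect-capT≡capture (suc t) D 1 refl (ℕ.+-suc D 0) (end≡ t D)))
  where
  n = suc (t ℕ.+ suc (suc D) ℕ.+ 0)
  x = suc (t ℕ.+ D)
  E : ℕ → ℚ
  E u = expect (walks n (suc (D ℕ.+ 0)) u) (capT n (suc t))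
  wall≡ : ∀ t D → suc (suc (suc (t ℕ.+ D))) ≡ suc (t ℕ.+ suc (suc D) ℕ.+ 0)
  wall≡ = solve-∀
  end≡ : ∀ t D → suc (suc t ℕ.+ D ℕ.+ 1) ≡ suc (t ℕ.+ suc (suc D) ℕ.+ 0)
  end≡ = solve-∀
expect-capT≡capture t (suc (suc D)) (suc d) refl refl refl =
  trans (expect-capT-ahead t D (suc d) (suc (D ℕ.+ suc d)))
    (trans (neighbourMean-interior n x E (subst (suc (suc x) ℕ.<_) (inside≡ t D d) (ℕ.m<m+n _ (s≤s z≤n))))
           (cong₂ (λ a b → inv 2 * a + inv 2 * b)
             (expect-capT≡capture (suc t) D (suc (suc d)) refl (ℕ.+-suc D (suc d)) (left≡ t D d))
             (expect-capT≡capture (suc t) (suc (suc D)) d (right-robber≡ t D) (right-rounds≡ D d) (right≡ t D d))))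
  where
  n = suc (t ℕ.+ suc (suc D) ℕ.+ suc d)
  x = suc (t ℕ.+ D)
  E : ℕ → ℚ
  E u = expect (walks n (suc (D ℕ.+ suc d)) u) (capT n (suc t))
  inside≡ : ∀ t D d → suc (suc (suc (t ℕ.+ D))) ℕ.+ suc d ≡ suc (t ℕ.+ suc (suc D) ℕ.+ suc d)
  inside≡ = solve-∀
  left≡ : ∀ t D d → suc (suc t ℕ.+ D ℕ.+ suc (suc d)) ≡ suc (t ℕ.+ suc (suc D) ℕ.+ suc d)
  left≡ = solve-∀
  right-robber≡ : ∀ t D → suc t ℕ.+ suc (suc D) ≡ suc (suc (suc (t ℕ.+ D)))
  right-robber≡ = solve-∀
  right-rounds≡ : ∀ D d → suc (suc D) ℕ.+ d ≡ suc (D ℕ.+ suc d)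
  right-rounds≡ = solve-∀
  right≡ : ∀ t D d → suc (suc t ℕ.+ suc (suc D) ℕ.+ d) ≡ suc (t ℕ.+ suc (suc D) ℕ.+ suc d)
  right≡ = solve-∀

mean-toℚ : ∀ a c m → a ℕ.+ c ≡ 2 ℕ.* m → inv 2 * toℚ a + inv 2 * toℚ c ≡ toℚ m
mean-toℚ a c m a+c≡2m = begin
  inv 2 * toℚ a + inv 2 * toℚ c                ≡⟨ cong₂ _+_ (frac-* 1 1 a 0) (frac-* 1 1 c 0) ⟩
  + (1 ℕ.* a) / 2 + + (1 ℕ.* c) / 2            ≡⟨ frac-+ (1 ℕ.* a) 1 (1 ℕ.* c) 1 ⟩
  + (1 ℕ.* a ℕ.* 2 ℕ.+ 1 ℕ.* c ℕ.* 2) / 4      ≡⟨ frac-≡ (1 ℕ.* a ℕ.* 2 ℕ.+ 1 ℕ.* c ℕ.* 2) 3 m 0 (trans (sym (expand a c)) (trans (cong (ℕ._* 2) a+c≡2m) (rearrange m))) ⟩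
  toℚ m ∎
  where
  open ≡-Reasoning
  expand : ∀ a c → (a ℕ.+ c) ℕ.* 2 ≡ (1 ℕ.* a ℕ.* 2 ℕ.+ 1 ℕ.* c ℕ.* 2) ℕ.* 1
  expand = solve-∀
  rearrange : ∀ m → 2 ℕ.* m ℕ.* 2 ≡ m ℕ.* 4
  rearrange = solve-∀

mean-mono-≤ : ∀ {x x′ y y′} → x ≤ x′ → y ≤ y′ → inv 2 * x + inv 2 * y ≤ inv 2 * x′ + inv 2 * y′
mean-mono-≤ x≤x′ y≤y′ = ℚ.+-mono-≤ (*-monoʳ-≤-inv 2 x≤x′) (*-monoʳ-≤-inv 2 y≤y′)

capture-≤ : ∀ {k} t D d → D ℕ.+ d ≡ k → capture k t D d ≤ toℚ (t ℕ.+ D)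
capture-≤ t 0 d refl = toℚ-mono-≤ (ℕ.m≤m+n t 0)
capture-≤ t 1 d refl = ℚ.≤-reflexive (cong toℚ (ℕ.+-comm 1 t))
capture-≤ t (suc (suc D)) zero refl = begin
  capture (suc (D ℕ.+ 0)) (suc t) D 1 ≤⟨ capture-≤ (suc t) D 1 (ℕ.+-suc D 0) ⟩
  toℚ (suc t ℕ.+ D)                   ≤⟨ toℚ-mono-≤ (ℕ.≤-trans (ℕ.n≤1+n _) (ℕ.≤-reflexive (wall≡ t D))) ⟩
  toℚ (t ℕ.+ suc (suc D)) ∎
  where
  open ℚ.≤-Reasoning
  wall≡ : ∀ t D → suc (suc t ℕ.+ D) ≡ t ℕ.+ suc (suc D)
  wall≡ = solve-∀
capture-≤ t (suc (suc D)) (suc d) refl = begin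
  inv 2 * capture (suc (D ℕ.+ suc d)) (suc t) D (suc (suc d)) + inv 2 * capture (suc (D ℕ.+ suc d)) (suc t) (suc (suc D)) d
    ≤⟨ mean-mono-≤ (capture-≤ (suc t) D (suc (suc d)) (ℕ.+-suc D (suc d))) (capture-≤ (suc t) (suc (suc D)) d (rounds≡ D d)) ⟩
  inv 2 * toℚ (suc t ℕ.+ D) + inv 2 * toℚ (suc t ℕ.+ suc (suc D))
    ≡⟨ mean-toℚ (suc t ℕ.+ D) (suc t ℕ.+ suc (suc D)) (t ℕ.+ suc (suc D)) (positions t D) ⟩
  toℚ (t ℕ.+ suc (suc D)) ∎
  where
  open ℚ.≤-Reasoning
  rounds≡ : ∀ D d → suc (suc D) ℕ.+ d ≡ suc (D ℕ.+ suc d)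
  rounds≡ = solve-∀
  positions : ∀ t D → suc t ℕ.+ D ℕ.+ (suc t ℕ.+ suc (suc D)) ≡ 2 ℕ.* (t ℕ.+ suc (suc D))
  positions = solve-∀

module Potential (b : ℕ) where

  A : ℕ
  A = suc b ℕ.* suc (suc b)

  φ : ℕ → ℕ → ℚ
  φ D d = + (2 ℕ.* D ℕ.+ A) / suc (d ℕ.+ b)

  φ-nonNeg : ∀ D d → 0ℚ ≤ φ D d
  φ-nonNeg D d = frac-≤ 0 0 (2 ℕ.* D ℕ.+ A) (d ℕ.+ b) z≤n

  φ-wall : ∀ D → toℚ 1 + φ D 1 ≤ φ (suc (suc D)) 0
  φ-wall D = begin
    toℚ 1 + φ D 1                ≡⟨ frac-+ 1 0 (2 ℕ.* D ℕ.+ A) (suc b) ⟩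
    + W / (1 ℕ.* suc (suc b))    ≤⟨ frac-≤ W (suc b ℕ.+ 0) (2 ℕ.* suc (suc D) ℕ.+ A) b cross ⟩
    φ (suc (suc D)) 0 ∎
    where
    open ℚ.≤-Reasoning
    W = 1 ℕ.* suc (suc b) ℕ.+ (2 ℕ.* D ℕ.+ A) ℕ.* 1
    slack : ∀ D b → (1 ℕ.* suc (suc b) ℕ.+ (2 ℕ.* D ℕ.+ suc b ℕ.* suc (suc b)) ℕ.* 1) ℕ.* suc b ℕ.+ (2 ℕ.* D ℕ.+ 4 ℕ.* b ℕ.+ 8)
                  ≡ (2 ℕ.* suc (suc D) ℕ.+ suc b ℕ.* suc (suc b)) ℕ.* suc (suc b ℕ.+ 0)
    slack = solve-∀
    cross : W ℕ.* suc b ℕ.≤ (2 ℕ.* suc (suc D) ℕ.+ A) ℕ.* suc (suc b ℕ.+ 0)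
    cross = subst (W ℕ.* suc b ℕ.≤_) (slack D b) (ℕ.m≤m+n (W ℕ.* suc b) (2 ℕ.* D ℕ.+ 4 ℕ.* b ℕ.+ 8))

  φ-interior : ∀ D d → 2 ℕ.* suc (suc D) ℕ.≤ A →
    inv 2 * φ D (suc (suc d)) + inv 2 * φ (suc (suc D)) d ≤ φ (suc (suc D)) (suc d)
  φ-interior D d D+2≤A = begin
    inv 2 * φ D (suc (suc d)) + inv 2 * φ (suc (suc D)) d
      ≡⟨ cong₂ _+_ (frac-* 1 1 P (suc (suc d) ℕ.+ b)) (frac-* 1 1 Q (d ℕ.+ b)) ⟩
    + (1 ℕ.* P) / (2 ℕ.* suc (suc (suc d) ℕ.+ b)) + + (1 ℕ.* Q) / (2 ℕ.* suc (d ℕ.+ b))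
      ≡⟨ frac-+ (1 ℕ.* P) _ (1 ℕ.* Q) _ ⟩
    + N / (2 ℕ.* suc (suc (suc d) ℕ.+ b) ℕ.* (2 ℕ.* suc (d ℕ.+ b)))
      ≤⟨ frac-≤ N _ Q (suc d ℕ.+ b) (cancel (cross-identity D d b A) Q≤2y[y+1]) ⟩
    φ (suc (suc D)) (suc d) ∎
    where
    -- The convexity defect Q/(y(y+1)(y+2)) of x ↦ Q/x at y+1 is covered by the 2/(y+2)
    -- lost because the first numerator is P = Q - 4, exactly when Q ≤ 2y(y+1).
    open ℚ.≤-Reasoning
    P = 2 ℕ.* D ℕ.+ A
    Q = 2 ℕ.* suc (suc D) ℕ.+ A
    N = 1 ℕ.* P ℕ.* (2 ℕ.* suc (d ℕ.+ b)) ℕ.+ 1 ℕ.* Q ℕ.* (2 ℕ.* suc (suc (suc d) ℕ.+ b))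
    y = suc (d ℕ.+ b)
    cross-identity : ∀ D d b A →
      (1 ℕ.* (2 ℕ.* D ℕ.+ A) ℕ.* (2 ℕ.* suc (d ℕ.+ b)) ℕ.+ 1 ℕ.* (2 ℕ.* suc (suc D) ℕ.+ A) ℕ.* (2 ℕ.* suc (suc (suc d) ℕ.+ b)))
        ℕ.* suc (suc d ℕ.+ b) ℕ.+ 8 ℕ.* (suc (d ℕ.+ b) ℕ.* suc (suc (d ℕ.+ b)))
      ≡ (2 ℕ.* suc (suc D) ℕ.+ A) ℕ.* ((2 ℕ.* suc (suc (suc d) ℕ.+ b)) ℕ.* (2 ℕ.* suc (d ℕ.+ b))) ℕ.+ 4 ℕ.* (2 ℕ.* suc (suc D) ℕ.+ A)
    cross-identity = solve-∀
    cancel : ∀ {L R S T} → L ℕ.+ S ≡ R ℕ.+ T → T ℕ.≤ S → L ℕ.≤ R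
    cancel {L} {R} {S} e T≤S = ℕ.+-cancelʳ-≤ S L R (subst (ℕ._≤ R ℕ.+ S) (sym e) (ℕ.+-monoʳ-≤ R T≤S))
    A≤y[y+1] : A ℕ.≤ y ℕ.* suc y
    A≤y[y+1] = ℕ.*-mono-≤ (s≤s (ℕ.m≤n+m b d)) (s≤s (s≤s (ℕ.m≤n+m b d)))
    Q≤2y[y+1] : 4 ℕ.* Q ℕ.≤ 8 ℕ.* (y ℕ.* suc y)
    Q≤2y[y+1] = subst (4 ℕ.* Q ℕ.≤_) (double (y ℕ.* suc y))
      (ℕ.*-monoʳ-≤ 4 (ℕ.+-mono-≤ (ℕ.≤-trans D+2≤A A≤y[y+1]) A≤y[y+1]))
      where
      double : ∀ z → 4 ℕ.* (z ℕ.+ z) ≡ 8 ℕ.* z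
      double = solve-∀

  2[D+2]≤A⇒2D≤A : ∀ D → 2 ℕ.* suc (suc D) ℕ.≤ A → 2 ℕ.* D ℕ.≤ A
  2[D+2]≤A⇒2D≤A D = ℕ.≤-trans (ℕ.*-monoʳ-≤ 2 (ℕ.≤-trans (ℕ.n≤1+n D) (ℕ.n≤1+n (suc D))))

  capture-≥ : ∀ {k} t D d → D ℕ.+ d ≡ k → 2 ℕ.* D ℕ.≤ A → toℚ (t ℕ.+ D) ≤ capture k t D d + φ D d
  capture-≥ t 0 d refl _ =
    ℚ.≤-trans (ℚ.≤-reflexive (cong toℚ (ℕ.+-identityʳ t))) (x≤x+nonNeg (toℚ t) (φ-nonNeg 0 d))
  capture-≥ t 1 d refl _ =
    ℚ.≤-trans (ℚ.≤-reflexive (cong toℚ (ℕ.+-comm t 1))) (x≤x+nonNeg (toℚ (suc t)) (φ-nonNeg 1 d))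
  capture-≥ t (suc (suc D)) zero refl D+2≤A = begin
    toℚ (t ℕ.+ suc (suc D))      ≡⟨ trans (cong toℚ (shift t D)) (toℚ-+ (suc t ℕ.+ D) 1) ⟩
    toℚ (suc t ℕ.+ D) + toℚ 1   ≤⟨ ℚ.+-monoˡ-≤ (toℚ 1) (capture-≥ (suc t) D 1 (ℕ.+-suc D 0) (2[D+2]≤A⇒2D≤A D D+2≤A)) ⟩
    X + φ D 1 + toℚ 1           ≡⟨ swap X (φ D 1) (toℚ 1) ⟩
    X + (toℚ 1 + φ D 1)         ≤⟨ ℚ.+-monoʳ-≤ X (φ-wall D) ⟩
    X + φ (suc (suc D)) 0 ∎
    where
    open ℚ.≤-Reasoning
    X = capture (suc (D ℕ.+ 0)) (suc t) D 1
    shift : ∀ t D → t ℕ.+ suc (suc D) ≡ suc t ℕ.+ D ℕ.+ 1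
    shift = solve-∀
    swap : ∀ x p o → x + p + o ≡ x + (o + p)
    swap = solve 3 (λ x p o → x :+ p :+ o := x :+ (o :+ p)) refl
  capture-≥ t (suc (suc D)) (suc d) refl D+2≤A = begin
    toℚ (t ℕ.+ suc (suc D))
      ≡⟨ sym (mean-toℚ (suc t ℕ.+ D) (suc t ℕ.+ suc (suc D)) (t ℕ.+ suc (suc D)) (positions t D)) ⟩
    inv 2 * toℚ (suc t ℕ.+ D) + inv 2 * toℚ (suc t ℕ.+ suc (suc D))
      ≤⟨ mean-mono-≤ (capture-≥ (suc t) D (suc (suc d)) (ℕ.+-suc D (suc d)) (2[D+2]≤A⇒2D≤A D D+2≤A))
                     (capture-≥ (suc t) (suc (suc D)) d (rounds≡ D d) D+2≤A) ⟩
    inv 2 * (X + φ D (suc (suc d))) + inv 2 * (Y + φ (suc (suc D)) d)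
      ≡⟨ regroup (inv 2) X Y (φ D (suc (suc d))) (φ (suc (suc D)) d) ⟩
    (inv 2 * X + inv 2 * Y) + (inv 2 * φ D (suc (suc d)) + inv 2 * φ (suc (suc D)) d)
      ≤⟨ ℚ.+-monoʳ-≤ (inv 2 * X + inv 2 * Y) (φ-interior D d D+2≤A) ⟩
    (inv 2 * X + inv 2 * Y) + φ (suc (suc D)) (suc d) ∎
    where
    open ℚ.≤-Reasoning
    X = capture (suc (D ℕ.+ suc d)) (suc t) D (suc (suc d))
    Y = capture (suc (D ℕ.+ suc d)) (suc t) (suc (suc D)) d
    positions : ∀ t D → suc t ℕ.+ D ℕ.+ (suc t ℕ.+ suc (suc D)) ≡ 2 ℕ.* (t ℕ.+ suc (suc D))
    positions = solve-∀
    rounds≡ : ∀ D d → suc (suc D) ℕ.+ d ≡ suc (D ℕ.+ suc d)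
    rounds≡ = solve-∀
    regroup : ∀ h x y p q → h * (x + p) + h * (y + q) ≡ (h * x + h * y) + (h * p + h * q)
    regroup = solve 5 (λ h x y p q → h :* (x :+ p) :+ h :* (y :+ q) := (h :* x :+ h :* y) :+ (h :* p :+ h :* q)) refl

b+2≤2[b+1] : ∀ b → suc (suc b) ℕ.≤ 2 ℕ.* suc b
b+2≤2[b+1] b = subst (suc (suc b) ℕ.≤_) (double b) (ℕ.m≤m+n (suc (suc b)) b)
  where
  double : ∀ b → suc (suc b) ℕ.+ b ≡ 2 ℕ.* suc b
  double = solve-∀

square-between : ∀ m → ∃ λ b → 1 ℕ.≤ b × 4 ℕ.* suc m ℕ.≤ suc b ℕ.* suc b × suc b ℕ.* suc b ℕ.≤ 16 ℕ.* suc m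
square-between zero = 1 , s≤s z≤n , ℕ.≤-refl , ℕ.m≤m+n 4 12
square-between (suc m) with square-between m
... | b , 1≤b , lo , hi with 4 ℕ.* suc (suc m) ℕ.≤? suc b ℕ.* suc b
...   | yes lo′ = b , 1≤b , lo′ , ℕ.≤-trans hi (ℕ.*-monoʳ-≤ 16 (ℕ.n≤1+n (suc m)))
...   | no  lo≰ = suc b , s≤s z≤n , lo′ , hi′
  where
  grow : ∀ b → suc (suc b) ℕ.* suc (suc b) ≡ suc b ℕ.* suc b ℕ.+ (2 ℕ.* b ℕ.+ 3)
  grow = solve-∀
  next : ∀ m → 4 ℕ.* suc m ℕ.+ 4 ≡ 4 ℕ.* suc (suc m)
  next = solve-∀
  lo′ : 4 ℕ.* suc (suc m) ℕ.≤ suc (suc b) ℕ.* suc (suc b)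
  lo′ = subst₂ ℕ._≤_ (next m) (sym (grow b))
          (ℕ.+-mono-≤ lo (ℕ.≤-trans (ℕ.n≤1+n 4) (ℕ.+-monoˡ-≤ 3 (ℕ.*-monoʳ-≤ 2 1≤b))))
  hi′ : suc (suc b) ℕ.* suc (suc b) ℕ.≤ 16 ℕ.* suc (suc m)
  hi′ = ℕ.≤-trans (ℕ.*-mono-≤ (b+2≤2[b+1] b) (b+2≤2[b+1] b))
          (subst₂ ℕ._≤_ (quadruple b) (sym (ℕ.*-assoc 4 4 (suc (suc m)))) (ℕ.*-monoʳ-≤ 4 (ℕ.<⇒≤ (ℕ.≰⇒> lo≰))))
    where
    quadruple : ∀ b → 4 ℕ.* (suc b ℕ.* suc b) ≡ 2 ℕ.* suc b ℕ.* (2 ℕ.* suc b)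
    quadruple = solve-∀

ET≡mean-capture : ∀ m → ET (suc m) ≡ inv (suc m) * ∑ (suc m) (λ y → capture m 0 y (m ∸ y))
ET≡mean-capture m = cong (inv (suc m) *_)
  (trans (cong (foldr _+_ 0ℚ) (map-upTo (λ y → expect (walks (suc m) m y) (capT (suc m) 0)) (suc m)))
         (∑-cong (suc m) (λ y y<n → expect-capT≡capture 0 y (m ∸ y) refl (rounds y y<n) (cong suc (rounds y y<n)))))
  where
  rounds : ∀ y → y ℕ.< suc m → y ℕ.+ (m ∸ y) ≡ m
  rounds y (s≤s y≤m) = ℕ.m+[n∸m]≡n y≤m

ET-≤ : ∀ n → 1 ℕ.≤ n → ET n ≤ + (n ∸ 1) / 2
ET-≤ (suc m) _ = begin
  ET (suc m)                                           ≡⟨ ET≡mean-capture m ⟩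
  inv (suc m) * ∑ (suc m) (λ y → capture m 0 y (m ∸ y)) ≤⟨ *-monoʳ-≤-inv (suc m) (∑-mono-≤ (suc m) capture≤y) ⟩
  inv (suc m) * ∑ (suc m) toℚ                          ≡⟨ mean-upTo m ⟩
  + m / 2 ∎
  where
  open ℚ.≤-Reasoning
  capture≤y : ∀ y → y ℕ.< suc m → capture m 0 y (m ∸ y) ≤ toℚ y
  capture≤y y (s≤s y≤m) = capture-≤ 0 y (m ∸ y) (ℕ.m+[n∸m]≡n y≤m)

module _ (m b : ℕ) (lo : 4 ℕ.* suc m ℕ.≤ suc b ℕ.* suc b) (hi : suc b ℕ.* suc b ℕ.≤ 16 ℕ.* suc m) where
  open Potential b

  2y≤A : ∀ y → y ℕ.< suc m → 2 ℕ.* y ℕ.≤ A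
  2y≤A y y<n = ℕ.≤-trans (ℕ.*-mono-≤ (s≤s (s≤s (z≤n {2}))) (ℕ.<⇒≤ y<n))
                 (ℕ.≤-trans lo (ℕ.*-monoʳ-≤ (suc b) (ℕ.n≤1+n (suc b))))

  A≤32n : A ℕ.≤ 32 ℕ.* suc m
  A≤32n = ℕ.≤-trans (ℕ.*-monoʳ-≤ (suc b) (b+2≤2[b+1] b))
            (subst₂ ℕ._≤_ (rearrange b) (sym (ℕ.*-assoc 2 16 (suc m))) (ℕ.*-monoʳ-≤ 2 hi))
    where
    rearrange : ∀ b → 2 ℕ.* (suc b ℕ.* suc b) ≡ suc b ℕ.* (2 ℕ.* suc b)
    rearrange = solve-∀

  φ-≤-harmonic-term : ∀ y → y ℕ.< suc m → φ y (m ∸ y) ≤ toℚ (34 ℕ.* suc m) * inv (suc m ∸ y)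
  φ-≤-harmonic-term y (s≤s y≤m) = begin
    + (2 ℕ.* y ℕ.+ A) / suc (m ∸ y ℕ.+ b) ≤⟨ frac-≤ (2 ℕ.* y ℕ.+ A) (m ∸ y ℕ.+ b) (34 ℕ.* suc m) (m ∸ y) cross ⟩
    + (34 ℕ.* suc m) / suc (m ∸ y)               ≡⟨ sym (toℚ-*-inv (34 ℕ.* suc m) (m ∸ y)) ⟩
    toℚ (34 ℕ.* suc m) * inv (suc (m ∸ y))        ≡⟨ cong (λ z → toℚ (34 ℕ.* suc m) * inv z) (sym (ℕ.+-∸-assoc 1 y≤m)) ⟩
    toℚ (34 ℕ.* suc m) * inv (suc m ∸ y) ∎
    where
    open ℚ.≤-Reasoning
    numerator : 2 ℕ.* y ℕ.+ A ℕ.≤ 34 ℕ.* suc m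
    numerator = subst (2 ℕ.* y ℕ.+ A ℕ.≤_) (sum34 (suc m)) (ℕ.+-mono-≤ (ℕ.*-monoʳ-≤ 2 (ℕ.≤-trans y≤m (ℕ.n≤1+n m))) A≤32n)
      where
      sum34 : ∀ n → 2 ℕ.* n ℕ.+ 32 ℕ.* n ≡ 34 ℕ.* n
      sum34 = solve-∀
    cross : (2 ℕ.* y ℕ.+ A) ℕ.* suc (m ∸ y) ℕ.≤ 34 ℕ.* suc m ℕ.* suc (m ∸ y ℕ.+ b)
    cross = ℕ.*-mono-≤ numerator (s≤s (ℕ.m≤m+n (m ∸ y) b))

  ∑φ-≤ : ∑ (suc m) (λ y → φ y (m ∸ y)) ≤ toℚ (34 ℕ.* suc m) * toℚ (suc ⌊log₂ suc m ⌋)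
  ∑φ-≤ = begin
    ∑ (suc m) (λ y → φ y (m ∸ y))                                ≤⟨ ∑-mono-≤ (suc m) φ-≤-harmonic-term ⟩
    ∑ (suc m) (λ y → toℚ (34 ℕ.* suc m) * inv (suc m ∸ y))       ≡⟨ ∑-*ˡ (suc m) (toℚ (34 ℕ.* suc m)) (λ y → inv (suc m ∸ y)) ⟩
    toℚ (34 ℕ.* suc m) * ∑ (suc m) (λ y → inv (suc m ∸ y))       ≡⟨ cong (toℚ (34 ℕ.* suc m) *_) (∑-inv-reversed (suc m)) ⟩
    toℚ (34 ℕ.* suc m) * harmonic (suc m)                         ≤⟨ ℚ.*-monoˡ-≤-nonNeg (toℚ (34 ℕ.* suc m)) {{nonNeg}} (harmonic-≤-log₂ m) ⟩
    toℚ (34 ℕ.* suc m) * toℚ (suc ⌊log₂ suc m ⌋) ∎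
    where
    open ℚ.≤-Reasoning
    nonNeg = nonNegative (toℚ-nonNeg (34 ℕ.* suc m))

  ∑toℚ-≤-∑capture+∑φ : ∑ (suc m) toℚ ≤ ∑ (suc m) (λ y → capture m 0 y (m ∸ y)) + ∑ (suc m) (λ y → φ y (m ∸ y))
  ∑toℚ-≤-∑capture+∑φ = ℚ.≤-trans (∑-mono-≤ (suc m) lower) (ℚ.≤-reflexive (∑-+ (suc m) (λ y → capture m 0 y (m ∸ y)) (λ y → φ y (m ∸ y))))
    where
    lower : ∀ y → y ℕ.< suc m → toℚ y ≤ capture m 0 y (m ∸ y) + φ y (m ∸ y)
    lower y y<n@(s≤s y≤m) = capture-≥ 0 y (m ∸ y) (ℕ.m+[n∸m]≡n y≤m) (2y≤A y y<n)

  m/2-≤-ET+34[log+1] : + m / 2 ≤ ET (suc m) + toℚ (34 ℕ.* suc ⌊log₂ suc m ⌋)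
  m/2-≤-ET+34[log+1] = begin
    + m / 2                                       ≡⟨ sym (mean-upTo m) ⟩
    inv n * ∑ n toℚ                               ≤⟨ *-monoʳ-≤-inv n (ℚ.≤-trans ∑toℚ-≤-∑capture+∑φ (ℚ.+-monoʳ-≤ C ∑φ-≤)) ⟩
    inv n * (C + toℚ (34 ℕ.* n) * toℚ L)          ≡⟨ ℚ.*-distribˡ-+ (inv n) C (toℚ (34 ℕ.* n) * toℚ L) ⟩
    inv n * C + inv n * (toℚ (34 ℕ.* n) * toℚ L)  ≡⟨ cong₂ _+_ (sym (ET≡mean-capture m)) cancel ⟩
    ET n + toℚ (34 ℕ.* L) ∎
    where
    open ℚ.≤-Reasoning
    n = suc m
    L = suc ⌊log₂ n ⌋
    C = ∑ n (λ y → capture m 0 y (m ∸ y))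
    cancel : inv n * (toℚ (34 ℕ.* n) * toℚ L) ≡ toℚ (34 ℕ.* L)
    cancel = trans (cong (inv n *_) (trans (sym (toℚ-* (34 ℕ.* n) L)) (cong toℚ (rearrange n L))))
                   (inv-*-toℚ-cancel m (34 ℕ.* L))
      where
      rearrange : ∀ n L → 34 ℕ.* n ℕ.* L ≡ n ℕ.* (34 ℕ.* L)
      rearrange = solve-∀

log-slack : ∀ l → 1 ℕ.≤ l → toℚ (34 ℕ.* suc l) + inv 2 ≤ toℚ 69 * toℚ l
log-slack (suc l) _ = begin
  toℚ (34 ℕ.* suc (suc l)) + inv 2  ≡⟨ frac-+ (34 ℕ.* suc (suc l)) 0 1 1 ⟩
  + N / 2                           ≤⟨ frac-≤ N 1 (69 ℕ.* suc l) 0 (subst (N ℕ.* 1 ℕ.≤_) (slack l) (ℕ.m≤m+n (N ℕ.* 1) (70 ℕ.* l ℕ.+ 1))) ⟩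
  toℚ (69 ℕ.* suc l)                ≡⟨ toℚ-* 69 (suc l) ⟩
  toℚ 69 * toℚ (suc l) ∎
  where
  open ℚ.≤-Reasoning
  N = 34 ℕ.* suc (suc l) ℕ.* 2 ℕ.+ 1 ℕ.* 1
  slack : ∀ l → (34 ℕ.* suc (suc l) ℕ.* 2 ℕ.+ 1 ℕ.* 1) ℕ.* 1 ℕ.+ (70 ℕ.* l ℕ.+ 1) ≡ 69 ℕ.* suc l ℕ.* 2
  slack = solve-∀

half-suc : ∀ m → + suc m / 2 ≡ + m / 2 + inv 2
half-suc m = sym (trans (frac-+ m 1 1 1) (frac-≡ (m ℕ.* 2 ℕ.+ 1 ℕ.* 2) 3 (suc m) 1 (rearrange m)))
  where
  rearrange : ∀ m → (m ℕ.* 2 ℕ.+ 1 ℕ.* 2) ℕ.* 2 ≡ suc m ℕ.* 4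
  rearrange = solve-∀

ET-≥ : ∀ n → 2 ℕ.≤ n → + n / 2 - toℚ 69 * toℚ ⌊log₂ n ⌋ ≤ ET n
ET-≥ (suc m) (s≤s 1≤m) = p≤r+q⇒p-q≤r (+ suc m / 2) (toℚ 69 * toℚ l) (ET (suc m)) (begin
  + suc m / 2                                   ≡⟨ half-suc m ⟩
  + m / 2 + inv 2                               ≤⟨ ℚ.+-monoˡ-≤ (inv 2) bound ⟩
  ET (suc m) + toℚ (34 ℕ.* suc l) + inv 2       ≡⟨ ℚ.+-assoc (ET (suc m)) (toℚ (34 ℕ.* suc l)) (inv 2) ⟩
  ET (suc m) + (toℚ (34 ℕ.* suc l) + inv 2)     ≤⟨ ℚ.+-monoʳ-≤ (ET (suc m)) (log-slack l (⌊log₂⌋-mono-≤ (s≤s 1≤m))) ⟩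
  ET (suc m) + toℚ 69 * toℚ l ∎)
  where
  open ℚ.≤-Reasoning
  l = ⌊log₂ suc m ⌋
  bound : + m / 2 ≤ ET (suc m) + toℚ (34 ℕ.* suc l)
  bound = let b , _ , lo , hi = square-between m in m/2-≤-ET+34[log+1] m b lo hi

theorem3p1 : ((n : ℕ) → 1 Data.Nat.≤ n → ET n ≤ + (n ∸ 1) / 2)
    × ∃ λ (C : ℕ) → ∃ λ (N : ℕ) → (n : ℕ) → N Data.Nat.≤ n →
        + n / 2 - toℚ C * toℚ ⌊log₂ n ⌋ ≤ ET n
theorem3p1 = ET-≤ , 69 , 2 , ET-≥
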